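{- Let $p$ be an odd prime, $v$ an $n$-dimensional integral vector, and $Q$ an $n\times n$ primitive matrix generated from $v$. Then every $n\times n$ primitive matrix generated from $v$ can be obtained from $Q$ by a permutation of its columns.
   Context: An orthogonal matrix $Q$ is regular if $Qe=e$, where $e$ is the all-one vector. The level of a rational matrix $Q$ is the smallest positive integer $k$ with $kQ$ integral. A primitive matrix is a regular rational orthogonal matrix $Q$ of level $p$ such that $pQ$ has rank $1$ over $\mathbb{F}_p=\mathbb{Z}/p\mathbb{Z}$. A primitive matrix $Q$ is generated from an integral vector $v$ if each column of $pQ$ is a multiple of $v$ over $\mathbb{F}_p$. -}

module Defs where

open import Data.Nat as ℕ using (ℕ; zero; suc; _≤_; _<_)
open import Data.Integer as ℤ using (ℤ; +_)
open import Data.Rational using (ℚ; _+_; _*_; _-_; 0ℚ; 1ℚ; _/_)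
open import Data.Fin using (Fin; zero; suc)
open import Data.Fin.Permutation using (Permutation′; _⟨$⟩ʳ_)
open import Data.Nat.Primality using (Prime)
open import Data.Product using (Σ; ∃; _×_; _,_)
open import Relation.Binary.PropositionalEquality using (_≡_)
open import Relation.Nullary using (¬_; yes; no)
open import Data.Fin using (_≟_)

-- n × n rational matrices, indexed (row, column)
Matrix : ℕ → Set
Matrix n = Fin n → Fin n → ℚ

ι : ℤ → ℚ
ι z = z / 1

Σℚ : {n : ℕ} → (Fin n → ℚ) → ℚ
Σℚ {zero}  f = 0ℚ
Σℚ {suc n} f = f zero + Σℚ (λ i → f (suc i))

δ : {n : ℕ} → Fin n → Fin n → ℚ
δ i j with i ≟ j
... | yes _ = 1ℚ
... | no  _ = 0ℚ

Orthogonal : {n : ℕ} → Matrix n → Set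
Orthogonal {n} Q = ∀ i j → Σℚ (λ k → Q k i * Q k j) ≡ δ i j

Regular : {n : ℕ} → Matrix n → Set
Regular {n} Q = ∀ i → Σℚ (λ j → Q i j) ≡ 1ℚ

IsInt : ℚ → Set
IsInt x = ∃ λ (z : ℤ) → x ≡ ι z

ScaledIntegral : {n : ℕ} → ℕ → Matrix n → Set
ScaledIntegral k Q = ∀ i j → IsInt (ι (+ k) * Q i j)

HasLevel : {n : ℕ} → ℕ → Matrix n → Set
HasLevel k Q = 0 < k × ScaledIntegral k Q
             × (∀ m → 0 < m → ScaledIntegral m Q → k ≤ m)

_≡_[mod_] : ℚ → ℚ → ℕ → Set
x ≡ y [mod p ] = ∃ λ (z : ℤ) → x - y ≡ ι (+ p) * ι z

scale : {n : ℕ} → ℕ → Matrix n → Matrix n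
scale p Q i j = ι (+ p) * Q i j

-- pQ has rank exactly 1 over 𝔽_p: nonzero mod p, and every column is a
-- multiple (mod p) of a single vector u
RankOneModP : {n : ℕ} → ℕ → Matrix n → Set
RankOneModP {n} p Q =
  (∃ λ (u : Fin n → ℤ) → ∃ λ (c : Fin n → ℤ) →
     ∀ i j → scale p Q i j ≡ ι (c j) * ι (u i) [mod p ])
  × (∃ λ i → ∃ λ j → ¬ (scale p Q i j ≡ 0ℚ [mod p ]))

Primitive : {n : ℕ} → ℕ → Matrix n → Set
Primitive p Q = Orthogonal Q × Regular Q × HasLevel p Q × RankOneModP p Q

ColumnsMultipleOf : {n : ℕ} → ℕ → (Fin n → ℤ) → Matrix n → Set
ColumnsMultipleOf {n} p v Q =
  ∀ j → ∃ λ (c : ℤ) → ∀ i → scale p Q i j ≡ ι c * ι (v i) [mod p ]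

PrimitiveGeneratedFrom : {n : ℕ} → ℕ → (Fin n → ℤ) → Matrix n → Set
PrimitiveGeneratedFrom p v Q = Primitive p Q × ColumnsMultipleOf p v Q

ColumnPermutationOf : {n : ℕ} → Matrix n → Matrix n → Set
ColumnPermutationOf {n} Q' Q =
  ∃ λ (σ : Permutation′ n) → ∀ i j → Q' i j ≡ Q i (σ ⟨$⟩ʳ j)

module Submission where

-- Let C j be the j-th column of the integral matrix pQ: the C j are pairwise orthogonal of norm
-- p², the rows of pQ sum to p, every C j is congruent mod p to a multiple of v, and some entry is
-- prime to p. If C′ k are the columns for a second such matrix, then p² (not merely p) divides
-- C j · C′ k: all these columns are congruent mod p to multiples of a single column a with an entry
-- prime to p, and writing them as such a multiple plus p times a remainder, the norm and
-- orthogonality relations make the remainders orthogonal to a mod p (this uses that p is odd).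
-- The integers t j = (C j · C′ k) / p² sum to 1, because rows and columns of pQ all sum to p,
-- so some t j ≥ 1, and then |C j - C′ k|² = 2p² - 2 C j · C′ k ≤ 0 forces C′ k = C j.
-- Matching columns in both directions gives the permutation.

open import Defs
open import Data.Nat using (ℕ)
open import Data.Nat.Primality using (Prime; euclidsLemma; prime⇒nonZero; prime⇒nonTrivial)
open import Data.Integer using (ℤ)
open import Data.Fin using (Fin)
open import Relation.Binary.PropositionalEquality using (_≢_)

open import Data.Nat as ℕ using (zero; suc)
open import Data.Integer as ℤ using (+_; -[1+_]; 0ℤ; 1ℤ; _+_; _*_; _-_; -_; _≤_; _<_)
import Data.Integer.Properties as ℤ
open import Data.Integer.Tactic.RingSolver using (solve-∀)
open import Data.Integer.Divisibility.Signed using (_∣_; divides; ∣-trans; ∣ᵤ⇒∣; ∣⇒∣ᵤ;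
  ∣m∣n⇒∣m+n; ∣m∣n⇒∣m-n; _∣?_; ∣n⇒∣m*n; ∣m⇒∣m*n; *-monoˡ-∣; *-cancelˡ-∣)
open _∣_ using (quotient; equality)
import Data.Nat.Divisibility as ℕ
import Data.Nat.Properties as ℕ
open import Data.Fin using (zero; suc; _≟_; punchIn)
import Data.Fin.Properties as Fin
open import Data.Fin.Permutation using (Permutation′; _⟨$⟩ʳ_; permutation)
open import Data.Vec.Functional using (Vector; removeAt)
open import Algebra.Properties.Semiring.Sum ℤ.+-*-semiring
  using (sum; sum-syntax; sum-cong-≗; sum-remove; sum-replicate-zero; ∑-comm; ∑-distrib-+;
         *-distribˡ-sum; *-distribʳ-sum)
open import Data.Rational as ℚ using (ℚ; 0ℚ; 1ℚ; toℚᵘ)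
import Data.Rational.Properties as ℚ
open import Algebra.Bundles using (CommutativeMonoid)
open import Algebra.Properties.CommutativeSemigroup
  (CommutativeMonoid.commutativeSemigroup ℚ.*-1-commutativeMonoid) using () renaming (interchange to ℚ-*-interchange)
open import Data.Rational.Unnormalised as ℚᵘ using (ℚᵘ; mkℚᵘ) renaming (_≃_ to _≃ᵘ_)
import Data.Rational.Unnormalised.Properties as ℚᵘ
open import Data.Product using (∃; _×_; _,_; proj₁; proj₂)
open import Data.Sum using (_⊎_; inj₁; inj₂; [_,_]′)
open import Relation.Nullary using (¬_; yes; no; contradiction)
open import Relation.Binary.PropositionalEquality
open import Function using (_∘_; id)

-- Sums and dot products of integer vectors

∑-*ˡ : ∀ {n} c (f : Vector ℤ n) → ∑[ l < n ] (c * f l) ≡ c * sum f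
∑-*ˡ c f = sym (*-distribˡ-sum c f)

∑-single : ∀ {n} (f : Vector ℤ n) i → (∀ j → j ≢ i → f j ≡ 0ℤ) → sum f ≡ f i
∑-single {suc n} f i f≡0 = begin
  sum f                   ≡⟨ sum-remove f ⟩
  f i + sum (removeAt f i) ≡⟨ cong (_+_ (f i)) (sum-cong-≗ (λ k → f≡0 (punchIn i k) (Fin.punchInᵢ≢i i k))) ⟩
  f i + ∑[ k < n ] 0ℤ     ≡⟨ cong (_+_ (f i)) (sum-replicate-zero n) ⟩
  f i + 0ℤ                ≡⟨ ℤ.+-identityʳ (f i) ⟩
  f i                     ∎
  where open ≡-Reasoning

∑-pos⇒∃pos : ∀ {n} (f : Vector ℤ n) → 0ℤ < sum f → ∃ λ j → 0ℤ < f j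
∑-pos⇒∃pos {zero}  f (ℤ.+<+ ())
∑-pos⇒∃pos {suc n} f ∑f>0 with f zero ℤ.≤? 0ℤ
... | no  f₀≰0 = zero , ℤ.≰⇒> f₀≰0
... | yes f₀≤0 with sum (f ∘ suc) ℤ.≤? 0ℤ
...   | yes rest≤0 = contradiction (ℤ.+-mono-≤ f₀≤0 rest≤0) (ℤ.<⇒≱ ∑f>0)
...   | no  rest≰0 = let j , f[j]>0 = ∑-pos⇒∃pos (f ∘ suc) (ℤ.≰⇒> rest≰0) in suc j , f[j]>0

∣-∑ : ∀ {n k} {f : Vector ℤ n} → (∀ i → k ∣ f i) → k ∣ sum f
∣-∑ {zero}  _    = divides 0ℤ refl
∣-∑ {suc n} k∣fᵢ = ∣m∣n⇒∣m+n (k∣fᵢ zero) (∣-∑ (k∣fᵢ ∘ suc))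

∣-⇒≡+* : ∀ {k s t} → k ∣ s - t → ∃ λ q → s ≡ t + k * q
∣-⇒≡+* {k} {s} {t} (divides q s-t≡qk) = q , (begin
  s             ≡⟨ split s t ⟩
  t + (s - t)   ≡⟨ cong (_+_ t) s-t≡qk ⟩
  t + q * k     ≡⟨ cong (_+_ t) (ℤ.*-comm q k) ⟩
  t + k * q     ∎)
  where
  open ≡-Reasoning
  split : ∀ s t → s ≡ t + (s - t)
  split = solve-∀

infix 7 _·_

_·_ : ∀ {n} → Vector ℤ n → Vector ℤ n → ℤ
_·_ {n} x y = ∑[ l < n ] (x l * y l)

·-cong : ∀ {n} {x x′ y y′ : Vector ℤ n} → (∀ l → x l ≡ x′ l) → (∀ l → y l ≡ y′ l) →
         x · y ≡ x′ · y′
·-cong x≗x′ y≗y′ = sum-cong-≗ (λ l → cong₂ _*_ (x≗x′ l) (y≗y′ l))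

·-comm : ∀ {n} (x y : Vector ℤ n) → x · y ≡ y · x
·-comm x y = sum-cong-≗ (λ l → ℤ.*-comm (x l) (y l))

·-scaleˡ : ∀ {n} α (x y : Vector ℤ n) → (λ l → α * x l) · y ≡ α * (x · y)
·-scaleˡ α x y = trans (sum-cong-≗ (λ l → ℤ.*-assoc α (x l) (y l))) (∑-*ˡ α (λ l → x l * y l))

·-scale : ∀ {n} α β (x y : Vector ℤ n) → (λ l → α * x l) · (λ l → β * y l) ≡ α * (β * (x · y))
·-scale {n} α β x y = begin
  ∑[ l < n ] (α * x l * (β * y l)) ≡⟨ sum-cong-≗ (λ l → rearrange α β (x l) (y l)) ⟩
  ∑[ l < n ] (α * (β * (x l * y l))) ≡⟨ ∑-*ˡ α (λ l → β * (x l * y l)) ⟩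
  α * ∑[ l < n ] (β * (x l * y l)) ≡⟨ cong (α *_) (∑-*ˡ β (λ l → x l * y l)) ⟩
  α * (β * (x · y)) ∎
  where
  open ≡-Reasoning
  rearrange : ∀ α β a b → α * a * (β * b) ≡ α * (β * (a * b))
  rearrange = solve-∀

·-linearˡ : ∀ {n} c d (f g h : Vector ℤ n) →
            (λ l → c * f l + d * g l) · h ≡ c * (f · h) + d * (g · h)
·-linearˡ {n} c d f g h = begin
  ∑[ l < n ] ((c * f l + d * g l) * h l)
    ≡⟨ sum-cong-≗ (λ l → distrib c d (f l) (g l) (h l)) ⟩
  ∑[ l < n ] (c * (f l * h l) + d * (g l * h l))
    ≡⟨ ∑-distrib-+ (λ l → c * (f l * h l)) (λ l → d * (g l * h l)) ⟩
  ∑[ l < n ] (c * (f l * h l)) + ∑[ l < n ] (d * (g l * h l))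
    ≡⟨ cong₂ _+_ (∑-*ˡ c (λ l → f l * h l)) (∑-*ˡ d (λ l → g l * h l)) ⟩
  c * (f · h) + d * (g · h) ∎
  where
  open ≡-Reasoning
  distrib : ∀ c d a b x → (c * a + d * b) * x ≡ c * (a * x) + d * (b * x)
  distrib = solve-∀

·-bilinear : ∀ {n} c d c′ d′ (f g f′ g′ : Vector ℤ n) →
  (λ l → c * f l + d * g l) · (λ l → c′ * f′ l + d′ * g′ l)
  ≡ c * (c′ * (f · f′) + d′ * (f · g′)) + d * (c′ * (g · f′) + d′ * (g · g′))
·-bilinear c d c′ d′ f g f′ g′ = begin
  (λ l → c * f l + d * g l) · y                         ≡⟨ ·-linearˡ c d f g y ⟩
  c * (f · y) + d * (g · y)                             ≡⟨ cong₂ (λ s t → c * s + d * t) (expand f) (expand g) ⟩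
  c * (c′ * (f · f′) + d′ * (f · g′)) + d * (c′ * (g · f′) + d′ * (g · g′)) ∎
  where
  open ≡-Reasoning
  y = λ l → c′ * f′ l + d′ * g′ l
  expand : ∀ h → h · y ≡ c′ * (h · f′) + d′ * (h · g′)
  expand h = begin
    h · y                       ≡⟨ ·-comm h y ⟩
    y · h                       ≡⟨ ·-linearˡ c′ d′ f′ g′ h ⟩
    c′ * (f′ · h) + d′ * (g′ · h) ≡⟨ cong₂ (λ s t → c′ * s + d′ * t) (·-comm f′ h) (·-comm g′ h) ⟩
    c′ * (h · f′) + d′ * (h · g′) ∎

·-decomposed : ∀ {n} α c d k (x y a w w′ : Vector ℤ n) →
  (∀ l → α * x l ≡ c * a l + k * w l) → (∀ l → α * y l ≡ d * a l + k * w′ l) →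
  α * (α * (x · y)) ≡ c * (d * (a · a) + k * (a · w′)) + k * (d * (w · a) + k * (w · w′))
·-decomposed α c d k x y a w w′ αx≡ αy≡ = begin
  α * (α * (x · y))                                   ≡⟨ ·-scale α α x y ⟨
  (λ l → α * x l) · (λ l → α * y l)                   ≡⟨ ·-cong αx≡ αy≡ ⟩
  (λ l → c * a l + k * w l) · (λ l → d * a l + k * w′ l) ≡⟨ ·-bilinear c k d k a w a w′ ⟩
  c * (d * (a · a) + k * (a · w′)) + k * (d * (w · a) + k * (w · w′)) ∎
  where open ≡-Reasoning

∑-· : ∀ {m n} (C : Fin m → Vector ℤ n) (y : Vector ℤ n) →
      ∑[ k < m ] (C k · y) ≡ (λ l → ∑[ k < m ] C k l) · y
∑-· {m} {n} C y = begin
  ∑[ k < m ] ∑[ l < n ] (C k l * y l) ≡⟨ ∑-comm (λ k l → C k l * y l) ⟩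
  ∑[ l < n ] ∑[ k < m ] (C k l * y l) ≡⟨ sum-cong-≗ (λ l → sym (*-distribʳ-sum (y l) (λ k → C k l))) ⟩
  ∑[ l < n ] (∑[ k < m ] C k l * y l) ∎
  where open ≡-Reasoning

*-self-nonNeg : ∀ z → 0ℤ ≤ z * z
*-self-nonNeg (+ n)    = subst (0ℤ ≤_) (sym (ℤ.+◃n≡+n (n ℕ.* n))) (ℤ.+≤+ ℕ.z≤n)
*-self-nonNeg -[1+ n ] = subst (0ℤ ≤_) (sym (ℤ.+◃n≡+n (suc n ℕ.* suc n))) (ℤ.+≤+ ℕ.z≤n)

·-self-nonNeg : ∀ {n} (x : Vector ℤ n) → 0ℤ ≤ x · x
·-self-nonNeg {zero}  x = ℤ.≤-refl
·-self-nonNeg {suc n} x = ℤ.+-mono-≤ (*-self-nonNeg (x zero)) (·-self-nonNeg (x ∘ suc))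

nonNeg+nonNeg≡0⇒≡0 : ∀ {a b} → 0ℤ ≤ a → 0ℤ ≤ b → a + b ≡ 0ℤ → a ≡ 0ℤ
nonNeg+nonNeg≡0⇒≡0 {+ zero}  _ _          _  = refl
nonNeg+nonNeg≡0⇒≡0 {+ suc _} _ (ℤ.+≤+ _) ()

·-self≡0⇒≡0 : ∀ {n} (x : Vector ℤ n) → x · x ≡ 0ℤ → ∀ l → x l ≡ 0ℤ
·-self≡0⇒≡0 {suc n} x x·x≡0 l = case l
  where
  x₀²≡0 : x zero * x zero ≡ 0ℤ
  x₀²≡0 = nonNeg+nonNeg≡0⇒≡0 (*-self-nonNeg (x zero)) (·-self-nonNeg (x ∘ suc)) x·x≡0
  case : ∀ l → x l ≡ 0ℤ
  case zero    = [ id , id ]′ (ℤ.i*j≡0⇒i≡0∨j≡0 (x zero) x₀²≡0)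
  case (suc l) = ·-self≡0⇒≡0 (x ∘ suc) (trans (sym (ℤ.+-identityˡ _))
                   (trans (cong (_+ (x ∘ suc) · (x ∘ suc)) (sym x₀²≡0)) x·x≡0)) l

·-self≡·⇒≡ : ∀ {n} {s} (x y : Vector ℤ n) → x · x ≡ s → y · y ≡ s → s ≤ x · y → ∀ l → x l ≡ y l
·-self≡·⇒≡ {s = s} x y x·x≡s y·y≡s s≤x·y l =
  ℤ.i-j≡0⇒i≡j (x l) (y l) (trans (sym (difference l)) (·-self≡0⇒≡0 d d·d≡0 l))
  where
  d = λ l → 1ℤ * x l + (- 1ℤ) * y l
  difference : ∀ l → d l ≡ x l - y l
  difference l = lemma (x l) (y l)
    where lemma : ∀ a b → 1ℤ * a + (- 1ℤ) * b ≡ a - b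
          lemma = solve-∀
  excess = x · y - s
  d·d+2excess≡0 : d · d + (excess + excess) ≡ 0ℤ
  d·d+2excess≡0 = begin
    d · d + (excess + excess)
      ≡⟨ cong (_+ (excess + excess)) (·-bilinear 1ℤ (- 1ℤ) 1ℤ (- 1ℤ) x y x y) ⟩
    1ℤ * (1ℤ * (x · x) + (- 1ℤ) * (x · y)) + (- 1ℤ) * (1ℤ * (y · x) + (- 1ℤ) * (y · y)) + (excess + excess)
      ≡⟨ substitute x·x≡s (·-comm y x) y·y≡s ⟩
    1ℤ * (1ℤ * s + (- 1ℤ) * (x · y)) + (- 1ℤ) * (1ℤ * (x · y) + (- 1ℤ) * s) + (excess + excess)
      ≡⟨ cancel s (x · y) ⟩
    0ℤ ∎
    where
    open ≡-Reasoning
    substitute : ∀ {a a′ b b′ c c′} → a ≡ a′ → b ≡ b′ → c ≡ c′ →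
      1ℤ * (1ℤ * a + (- 1ℤ) * (x · y)) + (- 1ℤ) * (1ℤ * b + (- 1ℤ) * c) + (excess + excess) ≡
      1ℤ * (1ℤ * a′ + (- 1ℤ) * (x · y)) + (- 1ℤ) * (1ℤ * b′ + (- 1ℤ) * c′) + (excess + excess)
    substitute refl refl refl = refl
    cancel : ∀ s t → 1ℤ * (1ℤ * s + (- 1ℤ) * t) + (- 1ℤ) * (1ℤ * t + (- 1ℤ) * s) + ((t - s) + (t - s)) ≡ 0ℤ
    cancel = solve-∀
  excess-nonNeg : 0ℤ ≤ excess
  excess-nonNeg = ℤ.i≤j⇒0≤j-i s≤x·y
  d·d≡0 : d · d ≡ 0ℤ
  d·d≡0 = nonNeg+nonNeg≡0⇒≡0 (·-self-nonNeg d) (ℤ.+-mono-≤ excess-nonNeg excess-nonNeg) d·d+2excess≡0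

-- The integers inside ℚ

ιᵘ : ℤ → ℚᵘ
ιᵘ z = mkℚᵘ z 0

toℚᵘ-ι : ∀ z → toℚᵘ (ι z) ≃ᵘ ιᵘ z
toℚᵘ-ι z = ℚ.toℚᵘ-fromℚᵘ (ιᵘ z)

ι-+ : ∀ a b → ι (a + b) ≡ ι a ℚ.+ ι b
ι-+ a b = ℚ.toℚᵘ-injective (begin
  toℚᵘ (ι (a + b))            ≈⟨ toℚᵘ-ι (a + b) ⟩
  ιᵘ (a + b)                  ≈⟨ ℚᵘ.*≡* (lemma a b) ⟩
  ιᵘ a ℚᵘ.+ ιᵘ b              ≈⟨ ℚᵘ.+-cong (toℚᵘ-ι a) (toℚᵘ-ι b) ⟨
  toℚᵘ (ι a) ℚᵘ.+ toℚᵘ (ι b)  ≈⟨ ℚ.toℚᵘ-homo-+ (ι a) (ι b) ⟨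
  toℚᵘ (ι a ℚ.+ ι b)          ∎)
  where
  open ℚᵘ.≃-Reasoning
  lemma : ∀ a b → (a + b) * (1ℤ * 1ℤ) ≡ (a * 1ℤ + b * 1ℤ) * 1ℤ
  lemma = solve-∀

ι-* : ∀ a b → ι (a * b) ≡ ι a ℚ.* ι b
ι-* a b = ℚ.toℚᵘ-injective (begin
  toℚᵘ (ι (a * b))            ≈⟨ toℚᵘ-ι (a * b) ⟩
  ιᵘ (a * b)                  ≈⟨ ℚᵘ.*≡* (lemma a b) ⟩
  ιᵘ a ℚᵘ.* ιᵘ b              ≈⟨ ℚᵘ.*-cong (toℚᵘ-ι a) (toℚᵘ-ι b) ⟨
  toℚᵘ (ι a) ℚᵘ.* toℚᵘ (ι b)  ≈⟨ ℚ.toℚᵘ-homo-* (ι a) (ι b) ⟨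
  toℚᵘ (ι a ℚ.* ι b)          ∎)
  where
  open ℚᵘ.≃-Reasoning
  lemma : ∀ a b → (a * b) * (1ℤ * 1ℤ) ≡ (a * b) * 1ℤ
  lemma = solve-∀

ι-neg : ∀ a → ι (- a) ≡ ℚ.- ι a
ι-neg a = ℚ.toℚᵘ-injective (begin
  toℚᵘ (ι (- a))    ≈⟨ toℚᵘ-ι (- a) ⟩
  ℚᵘ.- ιᵘ a         ≈⟨ ℚᵘ.-‿cong (toℚᵘ-ι a) ⟨
  ℚᵘ.- toℚᵘ (ι a)   ≈⟨ ℚ.toℚᵘ-homo‿- (ι a) ⟨
  toℚᵘ (ℚ.- ι a)    ∎)
  where open ℚᵘ.≃-Reasoning

ι-- : ∀ a b → ι (a - b) ≡ ι a ℚ.- ι b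
ι-- a b = trans (ι-+ a (- b)) (cong (ι a ℚ.+_) (ι-neg b))

ι-injective : ∀ {a b} → ι a ≡ ι b → a ≡ b
ι-injective {a} {b} ιa≡ιb with ℚᵘ.≃-trans (ℚᵘ.≃-sym (toℚᵘ-ι a)) (ℚᵘ.≃-trans (ℚ.toℚᵘ-cong ιa≡ιb) (toℚᵘ-ι b))
... | ℚᵘ.*≡* a*1≡b*1 = ℤ.*-cancelʳ-≡ a b 1ℤ a*1≡b*1

ι-∑ : ∀ {n} (f : Vector ℤ n) → ι (sum f) ≡ Σℚ (ι ∘ f)
ι-∑ {zero}  f = refl
ι-∑ {suc n} f = trans (ι-+ (f zero) (sum (f ∘ suc))) (cong (ι (f zero) ℚ.+_) (ι-∑ (f ∘ suc)))

Σℚ-cong : ∀ {n} {f g : Fin n → ℚ} → (∀ i → f i ≡ g i) → Σℚ f ≡ Σℚ g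
Σℚ-cong {zero}  f≗g = refl
Σℚ-cong {suc n} f≗g = cong₂ ℚ._+_ (f≗g zero) (Σℚ-cong (f≗g ∘ suc))

Σℚ-*ˡ : ∀ {n} c (f : Fin n → ℚ) → Σℚ (λ i → c ℚ.* f i) ≡ c ℚ.* Σℚ f
Σℚ-*ˡ {zero}  c f = sym (ℚ.*-zeroʳ c)
Σℚ-*ˡ {suc n} c f = trans (cong (c ℚ.* f zero ℚ.+_) (Σℚ-*ˡ c (f ∘ suc))) (sym (ℚ.*-distribˡ-+ c (f zero) _))

δ-refl : ∀ {n} (i : Fin n) → δ i i ≡ 1ℚ
δ-refl i with i ≟ i
... | yes _   = refl
... | no  i≢i = contradiction refl i≢i

δ-≢ : ∀ {n} {i j : Fin n} → i ≢ j → δ i j ≡ 0ℚ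
δ-≢ {i = i} {j} i≢j with i ≟ j
... | yes i≡j = contradiction i≡j i≢j
... | no  _   = refl

ι[k]*-cancelˡ : ∀ k .{{_ : ℕ.NonZero k}} {a b} → ι (+ k) ℚ.* a ≡ ι (+ k) ℚ.* b → a ≡ b
ι[k]*-cancelˡ k ka≡kb = ℚ.≤-antisym (cancel ka≡kb) (cancel (sym ka≡kb))
  where
  cancel : ∀ {a b} → ι (+ k) ℚ.* a ≡ ι (+ k) ℚ.* b → a ℚ.≤ b
  cancel eq = ℚ.*-cancelˡ-≤-pos (ι (+ k)) {{ℚ.normalize-pos k 1}} (ℚ.≤-reflexive eq)

-- Integral columns modulo an odd prime

module OddPrime {p : ℕ} (p-prime : Prime p) (p≢2 : p ≢ 2) where

  instance
    p-nonZero : ℕ.NonZero p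
    p-nonZero = prime⇒nonZero p-prime

  P : ℤ
  P = + p

  P² : ℤ
  P² = P * P

  P≢0 : P ≢ 0ℤ
  P≢0 = ℕ.≢-nonZero⁻¹ p ∘ cong ℤ.∣_∣

  P²≢0 : P² ≢ 0ℤ
  P²≢0 = [ P≢0 , P≢0 ]′ ∘ ℤ.i*j≡0⇒i≡0∨j≡0 P

  instance
    P²-nonZero : ℤ.NonZero P²
    P²-nonZero = ℤ.≢-nonZero P²≢0

    P²-nonNegative : ℤ.NonNegative P²
    P²-nonNegative = ℤ.nonNegative (*-self-nonNeg P)

  P∣*⇒P∣⊎P∣ : ∀ {a b} → P ∣ a * b → P ∣ a ⊎ P ∣ b
  P∣*⇒P∣⊎P∣ {a} {b} P∣ab
    with euclidsLemma ℤ.∣ a ∣ ℤ.∣ b ∣ p-prime (subst (p ℕ.∣_) (ℤ.abs-* a b) (∣⇒∣ᵤ P∣ab))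
  ... | inj₁ p∣a = inj₁ (∣ᵤ⇒∣ p∣a)
  ... | inj₂ p∣b = inj₂ (∣ᵤ⇒∣ p∣b)

  P∤*⇒P∣ : ∀ {a b} → ¬ P ∣ a → P ∣ a * b → P ∣ b
  P∤*⇒P∣ P∤a P∣ab with P∣*⇒P∣⊎P∣ P∣ab
  ... | inj₁ P∣a = contradiction P∣a P∤a
  ... | inj₂ P∣b = P∣b

  P∤2 : ¬ P ∣ + 2
  P∤2 P∣2 = ℕ.<⇒≱ (ℕ.≤∧≢⇒< (ℕ.∣⇒≤ (∣⇒∣ᵤ P∣2)) p≢2) (ℕ.nonTrivial⇒n>1 p {{prime⇒nonTrivial p-prime}})

  P²∣⇒P∣ : ∀ {a} → P² ∣ a → P ∣ a
  P²∣⇒P∣ = ∣-trans (divides P refl)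

  P∣∧P∣⇒P²∣* : ∀ {a b} → P ∣ a → P ∣ b → P² ∣ a * b
  P∣∧P∣⇒P²∣* (divides q refl) (divides r refl) = divides (q * r) (rearrange q r P)
    where rearrange : ∀ q r P → q * P * (r * P) ≡ q * r * (P * P)
          rearrange = solve-∀

  P²-cancelˡ : ∀ {α z} → ¬ P ∣ α → P² ∣ α * (α * z) → P² ∣ z
  P²-cancelˡ {α} {z} P∤α P²∣α²z with P∤*⇒P∣ P∤α (P∤*⇒P∣ P∤α (P²∣⇒P∣ P²∣α²z))
  ... | divides z′ refl = *-monoˡ-∣ P (P∤*⇒P∣ P∤α (P∤*⇒P∣ P∤α P∣α²z′))
    where
    rearrange : ∀ α z′ P → α * (α * (z′ * P)) ≡ P * (α * (α * z′))
    rearrange = solve-∀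
    P∣α²z′ : P ∣ α * (α * z′)
    P∣α²z′ = *-cancelˡ-∣ P (subst (P² ∣_) (rearrange α z′ P) P²∣α²z)

  record MultipleOf {n} (v x : Vector ℤ n) : Set where
    constructor multiple
    field
      factor    : ℤ
      congruent : ∀ i → P ∣ x i - factor * v i

  -- For p ∤ a i this says x ≡ (x i / a i) · a (mod p), stated without division.
  record ParallelAt {n} (i : Fin n) (a x : Vector ℤ n) : Set where
    constructor parallel
    field
      minor : ∀ l → P ∣ a i * x l - x i * a l

  multiples⇒parallelAt : ∀ {n} {v a x : Vector ℤ n} →
    MultipleOf v a → MultipleOf v x → ∀ i → ParallelAt i a x
  multiples⇒parallelAt {v = v} {a} {x} (multiple γ a≡γv) (multiple c x≡cv) i = parallel λ l →
    subst (P ∣_) (sym (minor (a i) (x i) (a l) (x l) γ c (v i) (v l)))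
      (∣m∣n⇒∣m+n (∣m∣n⇒∣m-n (∣m⇒∣m*n (x l) (a≡γv i)) (∣m⇒∣m*n (a l) (x≡cv i)))
                 (∣m∣n⇒∣m-n (∣n⇒∣m*n (γ * v i) (x≡cv l)) (∣n⇒∣m*n (c * v i) (a≡γv l))))
    where
    minor : ∀ aᵢ xᵢ aₗ xₗ γ c vᵢ vₗ →
      aᵢ * xₗ - xᵢ * aₗ
      ≡ ((aᵢ - γ * vᵢ) * xₗ - (xᵢ - c * vᵢ) * aₗ) + (γ * vᵢ * (xₗ - c * vₗ) - c * vᵢ * (aₗ - γ * vₗ))
    minor = solve-∀

  parallelAt⇒divisible : ∀ {n} {i : Fin n} {a y : Vector ℤ n} →
    ¬ P ∣ a i → ParallelAt i a y → P ∣ y i → ∀ l → P ∣ y l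
  parallelAt⇒divisible {i = i} {a} {y} P∤aᵢ (parallel a∥y) P∣yᵢ l =
    P∤*⇒P∣ P∤aᵢ (subst (P ∣_) (cancel (a i * y l) (y i * a l)) (∣m∣n⇒∣m+n (a∥y l) (∣m⇒∣m*n (a l) P∣yᵢ)))
    where cancel : ∀ s t → s - t + t ≡ s
          cancel = solve-∀

  parallelAt⇒decomposition : ∀ {n} {i : Fin n} {a x : Vector ℤ n} → ParallelAt i a x →
    ∃ λ w → ∀ l → a i * x l ≡ x i * a l + P * w l
  parallelAt⇒decomposition {i = i} {a} {x} (parallel a∥x) = (λ l → proj₁ (decompose l)) , (λ l → proj₂ (decompose l))
    where decompose = λ l → ∣-⇒≡+* {s = a i * x l} {t = x i * a l} (a∥x l)

  P∣remainder·a : ∀ {n} α x₀ (a x w : Vector ℤ n) → (∀ l → α * x l ≡ x₀ * a l + P * w l) →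
    a · a ≡ P² → P² ∣ x · a → P ∣ w · a
  P∣remainder·a α x₀ a x w αx≡ a·a≡P² P²∣x·a =
    *-cancelˡ-∣ P (subst (P² ∣_) (isolate α x₀ P (x · a) (a · a) (w · a) αx·a≡)
      (∣m∣n⇒∣m-n (∣n⇒∣m*n α P²∣x·a) (∣n⇒∣m*n x₀ (divides 1ℤ (trans a·a≡P² (sym (ℤ.*-identityˡ P²)))))))
    where
    open ≡-Reasoning
    αx·a≡ : α * (x · a) ≡ x₀ * (a · a) + P * (w · a)
    αx·a≡ = begin
      α * (x · a)                     ≡⟨ ·-scaleˡ α x a ⟨
      (λ l → α * x l) · a             ≡⟨ ·-cong αx≡ (λ _ → refl) ⟩
      (λ l → x₀ * a l + P * w l) · a  ≡⟨ ·-linearˡ x₀ P a w a ⟩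
      x₀ * (a · a) + P * (w · a)      ∎
    isolate : ∀ α x₀ P u v t → α * u ≡ x₀ * v + P * t → α * u - x₀ * v ≡ P * t
    isolate α x₀ P u v t eq = trans (cong (_- x₀ * v) eq) (cancel (x₀ * v) (P * t))
      where cancel : ∀ r s → r + s - r ≡ s
            cancel = solve-∀

  -- Expanding α² (y · y) leaves the cross term 2 p y₀ (a · w); it is here that p must be odd.
  P∣a·remainder : ∀ {n} α y₀ (a y w : Vector ℤ n) → ¬ P ∣ y₀ → (∀ l → α * y l ≡ y₀ * a l + P * w l) →
    a · a ≡ P² → y · y ≡ P² → P ∣ a · w
  P∣a·remainder α y₀ a y w P∤y₀ αy≡ a·a≡P² y·y≡P² =
    P∤*⇒P∣ P∤y₀ (P∤*⇒P∣ P∤2 (*-cancelˡ-∣ P (divides (α * α - y₀ * y₀ - w · w) P·2y₀A≡)))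
    where
    open ≡-Reasoning
    A = a · w
    B = w · w
    α²P²≡ : α * (α * P²) ≡ y₀ * (y₀ * P² + P * A) + P * (y₀ * A + P * B)
    α²P²≡ = begin
      α * (α * P²)                                          ≡⟨ cong (λ u → α * (α * u)) y·y≡P² ⟨
      α * (α * (y · y))                                     ≡⟨ ·-decomposed α y₀ y₀ P y y a w w αy≡ αy≡ ⟩
      y₀ * (y₀ * (a · a) + P * A) + P * (y₀ * (w · a) + P * B)
        ≡⟨ cong₂ (λ u v → y₀ * (y₀ * u + P * A) + P * (y₀ * v + P * B)) a·a≡P² (·-comm w a) ⟩
      y₀ * (y₀ * P² + P * A) + P * (y₀ * A + P * B)         ∎
    P·2y₀A≡ : P * (+ 2 * (y₀ * A)) ≡ (α * α - y₀ * y₀ - B) * P²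
    P·2y₀A≡ = begin
      P * (+ 2 * (y₀ * A))
        ≡⟨ isolate y₀ P A B ⟩
      y₀ * (y₀ * P²  + P * A) + P * (y₀ * A + P * B) - y₀ * (y₀ * P²) - P * (P * B)
        ≡⟨ cong (λ u → u - y₀ * (y₀ * P²) - P * (P * B)) α²P²≡ ⟨
      α * (α * P²) - y₀ * (y₀ * P²) - P * (P * B)
        ≡⟨ collect α y₀ P B ⟩
      (α * α - y₀ * y₀ - B) * P² ∎
      where
      isolate : ∀ y₀ P A B → P * (+ 2 * (y₀ * A))
        ≡ y₀ * (y₀ * (P * P) + P * A) + P * (y₀ * A + P * B) - y₀ * (y₀ * (P * P)) - P * (P * B)
      isolate = solve-∀
      collect : ∀ α y₀ P B →
        α * (α * (P * P)) - y₀ * (y₀ * (P * P)) - P * (P * B) ≡ (α * α - y₀ * y₀ - B) * (P * P)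
      collect = solve-∀

  -- Expand (a i)² (x · y) with a i x = x i a + p w and a i y = y i a + p w′.
  P²∣· : ∀ {n} (i : Fin n) {a x y : Vector ℤ n} → ¬ P ∣ a i → ¬ P ∣ y i →
    ParallelAt i a x → ParallelAt i a y → a · a ≡ P² → y · y ≡ P² → P² ∣ x · a → P² ∣ x · y
  P²∣· i {a} {x} {y} P∤α P∤y₀ a∥x a∥y a·a≡P² y·y≡P² P²∣x·a =
    P²-cancelˡ P∤α (divides (x₀ * y₀ + x₀ * s + y₀ * t + w · w′) α²x·y≡)
    where
    open ≡-Reasoning
    α = a i
    x₀ = x i
    y₀ = y i
    w = proj₁ (parallelAt⇒decomposition a∥x)
    αx≡ = proj₂ (parallelAt⇒decomposition a∥x)
    w′ = proj₁ (parallelAt⇒decomposition a∥y)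
    αy≡ = proj₂ (parallelAt⇒decomposition a∥y)
    P∣a·w′ = P∣a·remainder α y₀ a y w′ P∤y₀ αy≡ a·a≡P² y·y≡P²
    P∣w·a = P∣remainder·a α x₀ a x w αx≡ a·a≡P² P²∣x·a
    s = quotient P∣a·w′
    t = quotient P∣w·a

    α²x·y≡ : α * (α * (x · y)) ≡ (x₀ * y₀ + x₀ * s + y₀ * t + w · w′) * P²
    α²x·y≡ = begin
      α * (α * (x · y))
        ≡⟨ ·-decomposed α x₀ y₀ P x y a w w′ αx≡ αy≡ ⟩
      x₀ * (y₀ * (a · a) + P * (a · w′)) + P * (y₀ * (w · a) + P * (w · w′))
        ≡⟨ cong₂ (λ u v → x₀ * (y₀ * u + P * v) + P * (y₀ * (w · a) + P * (w · w′))) a·a≡P² (equality P∣a·w′) ⟩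
      x₀ * (y₀ * P² + P * (s * P)) + P * (y₀ * (w · a) + P * (w · w′))
        ≡⟨ cong (λ u → x₀ * (y₀ * P² + P * (s * P)) + P * (y₀ * u + P * (w · w′))) (equality P∣w·a) ⟩
      x₀ * (y₀ * P² + P * (s * P)) + P * (y₀ * (t * P) + P * (w · w′))
        ≡⟨ collect x₀ y₀ P s t (w · w′) ⟩
      (x₀ * y₀ + x₀ * s + y₀ * t + w · w′) * P² ∎
      where
      collect : ∀ x₀ y₀ P s t r → x₀ * (y₀ * (P * P) + P * (s * P)) + P * (y₀ * (t * P) + P * r)
                                  ≡ (x₀ * y₀ + x₀ * s + y₀ * t + r) * (P * P)
      collect = solve-∀

  -- The columns C j of the integral matrix pQ, for Q primitive of level p and generated from v.
  record ScaledPrimitive {n} (v : Vector ℤ n) (C : Fin n → Vector ℤ n) : Set where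
    field
      column-norm       : ∀ j → C j · C j ≡ P²
      column-orthogonal : ∀ {j k} → j ≢ k → C j · C k ≡ 0ℤ
      row-sum           : ∀ i → ∑[ j < n ] C j i ≡ P
      column-multiple   : ∀ j → MultipleOf v (C j)
      pivot-row         : Fin n
      pivot-column      : Fin n
      pivot-unit        : ¬ P ∣ C pivot-column pivot-row

    P²∣column·column : ∀ j k → P² ∣ C j · C k
    P²∣column·column j k with j ≟ k
    ... | yes refl = divides 1ℤ (trans (column-norm j) (sym (ℤ.*-identityˡ P²)))
    ... | no  j≢k  = divides 0ℤ (column-orthogonal j≢k)

    column-injective : ∀ {j k} → (∀ l → C j l ≡ C k l) → j ≡ k
    column-injective {j} {k} Cj≗Ck with j ≟ k
    ... | yes j≡k = j≡k
    ... | no  j≢k = contradiction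
      (trans (sym (column-norm j)) (trans (·-cong {x = C j} (λ _ → refl) Cj≗Ck) (column-orthogonal j≢k))) P²≢0

    ∑-column· : ∀ y → ∑[ k < n ] (C k · y) ≡ P * sum y
    ∑-column· y = trans (∑-· C y) (trans (·-cong row-sum (λ _ → refl)) (∑-*ˡ P y))

    column-sum : ∀ j → sum (C j) ≡ P
    column-sum j = ℤ.*-cancelˡ-≡ P (sum (C j)) P (begin
      P * sum (C j)             ≡⟨ ∑-column· (C j) ⟨
      ∑[ k < n ] (C k · C j)    ≡⟨ ∑-single (λ k → C k · C j) j (λ k k≢j → column-orthogonal k≢j) ⟩
      C j · C j                 ≡⟨ column-norm j ⟩
      P²                        ∎)
      where open ≡-Reasoning

    pivot-parallel : ∀ {y} → MultipleOf v y → ParallelAt pivot-row (C pivot-column) y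
    pivot-parallel y∼v = multiples⇒parallelAt (column-multiple pivot-column) y∼v pivot-row

    P∣pivot⇒P∣ : ∀ {y} → MultipleOf v y → P ∣ y pivot-row → ∀ l → P ∣ y l
    P∣pivot⇒P∣ y∼v = parallelAt⇒divisible pivot-unit (pivot-parallel y∼v)

    P²∣column· : ∀ {y} → MultipleOf v y → y · y ≡ P² → ¬ P ∣ y pivot-row → ∀ j → P² ∣ C j · y
    P²∣column· y∼v y·y≡P² P∤y j =
      P²∣· pivot-row pivot-unit P∤y (pivot-parallel (column-multiple j)) (pivot-parallel y∼v)
           (column-norm pivot-column) y·y≡P² (P²∣column·column j pivot-column)

  module _ {n} {v : Vector ℤ n} {C C′ : Fin n → Vector ℤ n}
           (R : ScaledPrimitive v C) (R′ : ScaledPrimitive v C′) where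
    private
      module R  = ScaledPrimitive R
      module R′ = ScaledPrimitive R′

    P²∣column·column′ : ∀ j k → P² ∣ C j · C′ k
    P²∣column·column′ j k with P ∣? C′ k R.pivot-row | P ∣? C j R′.pivot-row
    ... | no P∤C′ₖ | _ = R.P²∣column· (R′.column-multiple k) (R′.column-norm k) P∤C′ₖ j
    ... | yes _ | no P∤Cⱼ = subst (P² ∣_) (·-comm (C′ k) (C j))
                              (R′.P²∣column· (R.column-multiple j) (R.column-norm j) P∤Cⱼ k)
    ... | yes P∣C′ₖ | yes P∣Cⱼ = ∣-∑ λ l → P∣∧P∣⇒P²∣*
                                   (R′.P∣pivot⇒P∣ (R.column-multiple j) P∣Cⱼ l)
                                   (R.P∣pivot⇒P∣ (R′.column-multiple k) P∣C′ₖ l)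

    matching-column : ∀ k → ∃ λ j → ∀ l → C′ k l ≡ C j l
    matching-column k = j , λ l → sym (·-self≡·⇒≡ (C j) y (R.column-norm j) (R′.column-norm k) P²≤Cⱼ·y l)
      where
      y = C′ k
      t : Fin n → ℤ
      t j = quotient (P²∣column·column′ j k)
      ∑t≡1 : sum t ≡ 1ℤ
      ∑t≡1 = ℤ.*-cancelʳ-≡ (sum t) 1ℤ P² (begin
        sum t * P²             ≡⟨ *-distribʳ-sum P² t ⟩
        ∑[ j < n ] (t j * P²)  ≡⟨ sum-cong-≗ (λ j → equality (P²∣column·column′ j k)) ⟨
        ∑[ j < n ] (C j · y)   ≡⟨ R.∑-column· y ⟩
        P * sum y              ≡⟨ cong (P *_) (R′.column-sum k) ⟩
        P²                     ≡⟨ ℤ.*-identityˡ P² ⟨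
        1ℤ * P²                ∎)
        where open ≡-Reasoning
      positive = ∑-pos⇒∃pos t (subst (0ℤ <_) (sym ∑t≡1) (ℤ.+<+ ℕ.z<s))
      j = proj₁ positive
      P²≤Cⱼ·y : P² ≤ C j · y
      P²≤Cⱼ·y = begin
        P²        ≡⟨ ℤ.*-identityˡ P² ⟨
        1ℤ * P²   ≤⟨ ℤ.*-monoʳ-≤-nonNeg P² (ℤ.i<j⇒suc[i]≤j (proj₂ positive)) ⟩
        t j * P²  ≡⟨ equality (P²∣column·column′ j k) ⟨
        C j · y   ∎
        where open ℤ.≤-Reasoning

  column-permutation : ∀ {n} {v : Vector ℤ n} {C C′ : Fin n → Vector ℤ n} →
    ScaledPrimitive v C → ScaledPrimitive v C′ →
    ∃ λ (σ : Permutation′ n) → ∀ k l → C′ k l ≡ C (σ ⟨$⟩ʳ k) l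
  column-permutation {C = C} {C′} R R′ = permutation σ τ σ∘τ≡id τ∘σ≡id , λ k → proj₂ (matching-column R R′ k)
    where
    σ = λ k → proj₁ (matching-column R R′ k)
    τ = λ j → proj₁ (matching-column R′ R j)
    σ∘τ≡id : ∀ j → σ (τ j) ≡ j
    σ∘τ≡id j = ScaledPrimitive.column-injective R λ l →
      trans (sym (proj₂ (matching-column R R′ (τ j)) l)) (sym (proj₂ (matching-column R′ R j) l))
    τ∘σ≡id : ∀ k → τ (σ k) ≡ k
    τ∘σ≡id k = ScaledPrimitive.column-injective R′ λ l →
      trans (sym (proj₂ (matching-column R′ R (σ k)) l)) (sym (proj₂ (matching-column R R′ k) l))

  scaledColumns : ∀ {n} {v : Vector ℤ n} {Q : Matrix n} → PrimitiveGeneratedFrom p v Q →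
    ∃ λ C → ScaledPrimitive v C × (∀ i j → scale p Q i j ≡ ι (C j i))
  scaledColumns {n} {v} {Q} ((orthogonal , regular , (_ , integral , _) , (_ , i₀ , j₀ , P∤pQ)) , multiples) =
    C , scaledPrimitive , pQ≡C
    where
    open ≡-Reasoning
    C : Fin n → Vector ℤ n
    C j i = proj₁ (integral i j)
    pQ≡C : ∀ i j → scale p Q i j ≡ ι (C j i)
    pQ≡C i j = proj₂ (integral i j)

    ι[C·C] : ∀ j k → ι (C j · C k) ≡ ι P² ℚ.* δ j k
    ι[C·C] j k = begin
      ι (C j · C k)                                   ≡⟨ ι-∑ (λ l → C j l * C k l) ⟩
      Σℚ (λ l → ι (C j l * C k l))                    ≡⟨ Σℚ-cong (λ l → ι-* (C j l) (C k l)) ⟩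
      Σℚ (λ l → ι (C j l) ℚ.* ι (C k l))              ≡⟨ Σℚ-cong (λ l → cong₂ ℚ._*_ (pQ≡C l j) (pQ≡C l k)) ⟨
      Σℚ (λ l → ι P ℚ.* Q l j ℚ.* (ι P ℚ.* Q l k))    ≡⟨ Σℚ-cong (λ l → ℚ-*-interchange (ι P) (Q l j) (ι P) (Q l k)) ⟩
      Σℚ (λ l → ι P ℚ.* ι P ℚ.* (Q l j ℚ.* Q l k))    ≡⟨ Σℚ-*ˡ (ι P ℚ.* ι P) (λ l → Q l j ℚ.* Q l k) ⟩
      ι P ℚ.* ι P ℚ.* Σℚ (λ l → Q l j ℚ.* Q l k)      ≡⟨ cong₂ ℚ._*_ (sym (ι-* P P)) (orthogonal j k) ⟩
      ι P² ℚ.* δ j k                                  ∎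

    ι[row-sum] : ∀ i → ι (∑[ j < n ] C j i) ≡ ι P
    ι[row-sum] i = begin
      ι (∑[ j < n ] C j i)          ≡⟨ ι-∑ (λ j → C j i) ⟩
      Σℚ (λ j → ι (C j i))          ≡⟨ Σℚ-cong (pQ≡C i) ⟨
      Σℚ (λ j → ι P ℚ.* Q i j)      ≡⟨ Σℚ-*ˡ (ι P) (Q i) ⟩
      ι P ℚ.* Σℚ (Q i)              ≡⟨ cong (ι P ℚ.*_) (regular i) ⟩
      ι P ℚ.* 1ℚ                    ≡⟨ ℚ.*-identityʳ (ι P) ⟩
      ι P                           ∎

    column-multiple : ∀ j → MultipleOf v (C j)
    column-multiple j = multiple c λ i → divides (proj₁ (pQ≡cv i)) (ι-injective (begin
      ι (C j i - c * v i)               ≡⟨ ι-- (C j i) (c * v i) ⟩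
      ι (C j i) ℚ.- ι (c * v i)         ≡⟨ cong₂ ℚ._-_ (sym (pQ≡C i j)) (ι-* c (v i)) ⟩
      scale p Q i j ℚ.- ι c ℚ.* ι (v i) ≡⟨ proj₂ (pQ≡cv i) ⟩
      ι P ℚ.* ι (proj₁ (pQ≡cv i))       ≡⟨ ℚ.*-comm (ι P) _ ⟩
      ι (proj₁ (pQ≡cv i)) ℚ.* ι P       ≡⟨ ι-* (proj₁ (pQ≡cv i)) P ⟨
      ι (proj₁ (pQ≡cv i) * P)           ∎))
      where
      c = proj₁ (multiples j)
      pQ≡cv = proj₂ (multiples j)

    pivot-unit : ¬ P ∣ C j₀ i₀
    pivot-unit (divides z C≡zP) = P∤pQ (z , (begin
      scale p Q i₀ j₀ ℚ.- 0ℚ  ≡⟨ ℚ.+-identityʳ (scale p Q i₀ j₀) ⟩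
      scale p Q i₀ j₀         ≡⟨ pQ≡C i₀ j₀ ⟩
      ι (C j₀ i₀)             ≡⟨ cong ι C≡zP ⟩
      ι (z * P)               ≡⟨ ι-* z P ⟩
      ι z ℚ.* ι P             ≡⟨ ℚ.*-comm (ι z) (ι P) ⟩
      ι P ℚ.* ι z             ∎))

    scaledPrimitive : ScaledPrimitive v C
    scaledPrimitive = record
      { column-norm       = λ j → ι-injective (trans (ι[C·C] j j)
                              (trans (cong (ι P² ℚ.*_) (δ-refl j)) (ℚ.*-identityʳ (ι P²))))
      ; column-orthogonal = λ j≢k → ι-injective (trans (ι[C·C] _ _)
                              (trans (cong (ι P² ℚ.*_) (δ-≢ j≢k)) (ℚ.*-zeroʳ (ι P²))))
      ; row-sum           = λ i → ι-injective (ι[row-sum] i)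
      ; column-multiple   = column-multiple
      ; pivot-row         = i₀
      ; pivot-column      = j₀
      ; pivot-unit        = pivot-unit
      }

theorem2p15 : (p : ℕ) → Prime p → p ≢ 2 → (n : ℕ) → (v : Fin n → ℤ)
    → (Q : Matrix n) → PrimitiveGeneratedFrom p v Q
    → (Q' : Matrix n) → PrimitiveGeneratedFrom p v Q'
    → ColumnPermutationOf Q' Q
theorem2p15 p p-prime p≢2 n v Q Q-primitive Q′ Q′-primitive =
  let open OddPrime p-prime p≢2
      C  , R  , pQ≡C   = scaledColumns {v = v} {Q} Q-primitive
      C′ , R′ , pQ′≡C′ = scaledColumns {v = v} {Q′} Q′-primitive
      σ  , C′≡Cσ       = column-permutation R R′
  in  σ , λ i k → ι[k]*-cancelˡ p (begin
        scale p Q′ i k          ≡⟨ pQ′≡C′ i k ⟩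
        ι (C′ k i)              ≡⟨ cong ι (C′≡Cσ k i) ⟩
        ι (C (σ ⟨$⟩ʳ k) i)      ≡⟨ pQ≡C i (σ ⟨$⟩ʳ k) ⟨
        scale p Q i (σ ⟨$⟩ʳ k)  ∎)
  where open ≡-Reasoning
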